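{- In every calculus $\mathsf{G.WL}$ among the sequent calculi for W-logics, the following rules are height-preserving admissible (whenever the premiss is derivable, the conclusion is derivable by a derivation of at most the same height): left weakening, from $\Gamma\Rightarrow\Delta$ infer $\Gamma,A\Rightarrow\Delta$; right weakening, from $\Gamma\Rightarrow$ infer $\Gamma\Rightarrow A$; left contraction, from $\Gamma,A,A\Rightarrow\Delta$ infer $\Gamma,A\Rightarrow\Delta$.
   Context: The language $\mathcal{L}$ consists of the formulas built from a countable set $\mathrm{Atm}$ of propositional variables by $A ::= p \mid \bot \mid A\land A \mid A\lor A \mid A\to A \mid \Box A \mid \Diamond A$. Sequents: $\Gamma\Rightarrow\Delta$, $\Gamma$ a finite multiset of formulas, $\Delta$ a multiset of at most one formula; $\Box\Gamma$ denotes $\{\Box A: A\in\Gamma\}$ as a multiset. The height of a derivation is the length of its longest branch. In all rules $\Gamma,\Gamma'$ are arbitrary finite multisets and $\Delta$ has at most one formula. Propositional rules: (init) $\Gamma,p\Rightarrow p$ for $p\in\mathrm{Atm}$; (L$\bot$) $\Gamma,\bot\Rightarrow\Delta$; (L$\to$) from $\Gamma,A\to B\Rightarrow A$ and $\Gamma,B\Rightarrow\Delta$ infer $\Gamma,A\to B\Rightarrow\Delta$; (R$\to$) from $\Gamma,A\Rightarrow B$ infer $\Gamma\Rightarrow A\to B$; (R$\land$) from $\Gamma\Rightarrow A$ and $\Gamma\Rightarrow B$ infer $\Gamma\Rightarrow A\land B$; (L$\land$) from $\Gamma,A,B\Rightarrow\Delta$ infer $\Gamma,A\land B\Rightarrow\Delta$;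 (R$\lor$) from $\Gamma\Rightarrow A_i$ infer $\Gamma\Rightarrow A_1\lor A_2$ ($i=1,2$); (L$\lor$) from $\Gamma,A\Rightarrow\Delta$ and $\Gamma,B\Rightarrow\Delta$ infer $\Gamma,A\lor B\Rightarrow\Delta$. Modal rules: (M$_\Box$) from $A\Rightarrow B$ infer $\Gamma,\Box A\Rightarrow\Box B$; (M$_\Diamond$) from $A\Rightarrow B$ infer $\Gamma,\Diamond A\Rightarrow\Diamond B$; (Dual$_M$) from $A,B\Rightarrow$ infer $\Gamma,\Box A,\Diamond B\Rightarrow\Delta$; (N$_\Box$) from $\Rightarrow A$ infer $\Gamma\Rightarrow\Box A$; (N$_\Diamond$) from $A\Rightarrow$ infer $\Gamma,\Diamond A\Rightarrow\Delta$; (C$_\Box$) from $\Gamma,A\Rightarrow B$ infer $\Gamma',\Box\Gamma,\Box A\Rightarrow\Box B$; (C$_\Diamond$) from $\Gamma,A\Rightarrow B$ infer $\Gamma',\Box\Gamma,\Diamond A\Rightarrow\Diamond B$; (Dual$_C$) from $\Gamma,A,B\Rightarrow$ infer $\Gamma',\Box\Gamma,\Box A,\Diamond B\Rightarrow\Delta$; (K$_\Box$) from $\Gamma\Rightarrow A$ infer $\Gamma',\Box\Gamma\Rightarrow\Box A$; (K$_\Diamond$) from $\Gamma,A\Rightarrow B$ infer $\Gamma',\Box\Gamma,\Diamond A\Rightarrow\Diamond B$; (Dual$_K$) from $\Gamma,A\Rightarrow$ infer $\Gamma',\Box\Gamma,\Diamond A\Rightarrow\Delta$; (T$_\Box$)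 from $\Gamma,\Box A,A\Rightarrow\Delta$ infer $\Gamma,\Box A\Rightarrow\Delta$; (T$_\Diamond$) from $\Gamma\Rightarrow A$ infer $\Gamma\Rightarrow\Diamond A$; (P$_\Box$) from $A\Rightarrow$ infer $\Gamma,\Box A\Rightarrow\Delta$; (P$_\Diamond$) from $\Rightarrow A$ infer $\Gamma\Rightarrow\Diamond A$; (D) from $A\Rightarrow B$ infer $\Gamma,\Box A\Rightarrow\Diamond B$; (D$_\Box$) from $A,B\Rightarrow$ infer $\Gamma,\Box A,\Box B\Rightarrow\Delta$; (CD) from $\Gamma\Rightarrow A$ infer $\Gamma',\Box\Gamma\Rightarrow\Diamond A$; (CD$_\Box$) from $\Gamma\Rightarrow$ infer $\Gamma',\Box\Gamma\Rightarrow\Delta$. The calculi each contain all propositional rules plus: $\mathsf{G.WM}$: M$_\Box$, M$_\Diamond$, Dual$_M$; $\mathsf{G.WMP}$: $\mathsf{G.WM}$+P$_\Box$+P$_\Diamond$; $\mathsf{G.WMN}$: $\mathsf{G.WM}$+N$_\Box$+N$_\Diamond$; $\mathsf{G.WMNP}$: $\mathsf{G.WMN}$+P$_\Box$+P$_\Diamond$; $\mathsf{G.WMC}$: C$_\Box$, C$_\Diamond$, Dual$_C$; $\mathsf{G.WK}$: K$_\Box$, K$_\Diamond$, Dual$_K$; $\mathsf{G.WMD}$: $\mathsf{G.WM}$+D+D$_\Box$+P$_\Box$+P$_\Diamond$; $\mathsf{G.WMND}$: $\mathsf{G.WMN}$+D+D$_\Box$+P$_\Box$+P$_\Diamond$;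 $\mathsf{G.WMCD}$: $\mathsf{G.WMC}$+CD+CD$_\Box$; $\mathsf{G.WKD}$: $\mathsf{G.WK}$+CD+CD$_\Box$; $\mathsf{G.WMT}$, $\mathsf{G.WMNT}$, $\mathsf{G.WMCT}$, $\mathsf{G.WKT}$: respectively $\mathsf{G.WM}$, $\mathsf{G.WMN}$, $\mathsf{G.WMC}$, $\mathsf{G.WK}$ + T$_\Box$ + T$_\Diamond$. -}

module Defs where

open import Data.Nat using (ℕ; zero; suc; _⊔_; _≤_)
open import Data.List using (List; []; _∷_; _++_; map)
open import Data.List.Membership.Propositional using (_∈_)
open import Data.List.Relation.Binary.Permutation.Propositional using (_↭_)
open import Data.Maybe using (Maybe; just; nothing)
open import Data.Product using (Σ; _×_; _,_)

infixr 30 _∧_ _∨_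
infixr 25 _⇒f_
data Fm : Set where
  atom : ℕ → Fm
  ⊥f   : Fm
  _∧_  : Fm → Fm → Fm
  _∨_  : Fm → Fm → Fm
  _⇒f_ : Fm → Fm → Fm
  □_   : Fm → Fm
  ◇_   : Fm → Fm

-- Antecedents are finite multisets, represented by lists; every rule's
-- conclusion may be any list that is a permutation of the displayed one,
-- so derivability only depends on the underlying multiset.
Ctx : Set
Ctx = List Fm

Succ : Set
Succ = Maybe Fm

□* : Ctx → Ctx
□* Γ = map □_ Γ

data MRule : Set where
  M□ M◇ DualM N□ N◇ C□ C◇ DualC K□ K◇ DualK T□ T◇ P□ P◇ D D□ CD CD□ : MRule

data Calc : Set where
  WM WMP WMN WMNP WMC WK WMD WMND WMCD WKD WMT WMNT WMCT WKT : Calc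

rulesOf : Calc → List MRule
rulesOf WM   = M□ ∷ M◇ ∷ DualM ∷ []
rulesOf WMP  = M□ ∷ M◇ ∷ DualM ∷ P□ ∷ P◇ ∷ []
rulesOf WMN  = M□ ∷ M◇ ∷ DualM ∷ N□ ∷ N◇ ∷ []
rulesOf WMNP = M□ ∷ M◇ ∷ DualM ∷ N□ ∷ N◇ ∷ P□ ∷ P◇ ∷ []
rulesOf WMC  = C□ ∷ C◇ ∷ DualC ∷ []
rulesOf WK   = K□ ∷ K◇ ∷ DualK ∷ []
rulesOf WMD  = M□ ∷ M◇ ∷ DualM ∷ D ∷ D□ ∷ P□ ∷ P◇ ∷ []
rulesOf WMND = M□ ∷ M◇ ∷ DualM ∷ N□ ∷ N◇ ∷ D ∷ D□ ∷ P□ ∷ P◇ ∷ []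
rulesOf WMCD = C□ ∷ C◇ ∷ DualC ∷ CD ∷ CD□ ∷ []
rulesOf WKD  = K□ ∷ K◇ ∷ DualK ∷ CD ∷ CD□ ∷ []
rulesOf WMT  = M□ ∷ M◇ ∷ DualM ∷ T□ ∷ T◇ ∷ []
rulesOf WMNT = M□ ∷ M◇ ∷ DualM ∷ N□ ∷ N◇ ∷ T□ ∷ T◇ ∷ []
rulesOf WMCT = C□ ∷ C◇ ∷ DualC ∷ T□ ∷ T◇ ∷ []
rulesOf WKT  = K□ ∷ K◇ ∷ DualK ∷ T□ ∷ T◇ ∷ []

Has : Calc → MRule → Set
Has L r = r ∈ rulesOf L

data Der (L : Calc) : Ctx → Succ → Set where
  init : ∀ {Σ Γ p} → Σ ↭ (atom p ∷ Γ) → Der L Σ (just (atom p))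
  L⊥   : ∀ {Σ Γ Δ} → Σ ↭ (⊥f ∷ Γ) → Der L Σ Δ
  L→   : ∀ {Σ Γ A B Δ} → Σ ↭ ((A ⇒f B) ∷ Γ) →
         Der L ((A ⇒f B) ∷ Γ) (just A) → Der L (B ∷ Γ) Δ → Der L Σ Δ
  R→   : ∀ {Γ A B} → Der L (A ∷ Γ) (just B) → Der L Γ (just (A ⇒f B))
  R∧   : ∀ {Γ A B} → Der L Γ (just A) → Der L Γ (just B) → Der L Γ (just (A ∧ B))
  L∧   : ∀ {Σ Γ A B Δ} → Σ ↭ ((A ∧ B) ∷ Γ) → Der L (A ∷ B ∷ Γ) Δ → Der L Σ Δ
  R∨₁  : ∀ {Γ A B} → Der L Γ (just A) → Der L Γ (just (A ∨ B))
  R∨₂  : ∀ {Γ A B} → Der L Γ (just B) → Der L Γ (just (A ∨ B))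
  L∨   : ∀ {Σ Γ A B Δ} → Σ ↭ ((A ∨ B) ∷ Γ) →
         Der L (A ∷ Γ) Δ → Der L (B ∷ Γ) Δ → Der L Σ Δ
  rM□    : ∀ {Σ Γ A B} → Has L M□ → Σ ↭ (□ A ∷ Γ) →
           Der L (A ∷ []) (just B) → Der L Σ (just (□ B))
  rM◇    : ∀ {Σ Γ A B} → Has L M◇ → Σ ↭ (◇ A ∷ Γ) →
           Der L (A ∷ []) (just B) → Der L Σ (just (◇ B))
  rDualM : ∀ {Σ Γ A B Δ} → Has L DualM → Σ ↭ (□ A ∷ ◇ B ∷ Γ) →
           Der L (A ∷ B ∷ []) nothing → Der L Σ Δ
  rN□    : ∀ {Γ A} → Has L N□ → Der L [] (just A) → Der L Γ (just (□ A))
  rN◇    : ∀ {Σ Γ A Δ} → Has L N◇ → Σ ↭ (◇ A ∷ Γ) →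
           Der L (A ∷ []) nothing → Der L Σ Δ
  rC□    : ∀ {Σ Γ Γ' A B} → Has L C□ → Σ ↭ (□ A ∷ □* Γ ++ Γ') →
           Der L (A ∷ Γ) (just B) → Der L Σ (just (□ B))
  rC◇    : ∀ {Σ Γ Γ' A B} → Has L C◇ → Σ ↭ (◇ A ∷ □* Γ ++ Γ') →
           Der L (A ∷ Γ) (just B) → Der L Σ (just (◇ B))
  rDualC : ∀ {Σ Γ Γ' A B Δ} → Has L DualC → Σ ↭ (□ A ∷ ◇ B ∷ □* Γ ++ Γ') →
           Der L (A ∷ B ∷ Γ) nothing → Der L Σ Δ
  rK□    : ∀ {Σ Γ Γ' A} → Has L K□ → Σ ↭ (□* Γ ++ Γ') →
           Der L Γ (just A) → Der L Σ (just (□ A))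
  rK◇    : ∀ {Σ Γ Γ' A B} → Has L K◇ → Σ ↭ (◇ A ∷ □* Γ ++ Γ') →
           Der L (A ∷ Γ) (just B) → Der L Σ (just (◇ B))
  rDualK : ∀ {Σ Γ Γ' A Δ} → Has L DualK → Σ ↭ (◇ A ∷ □* Γ ++ Γ') →
           Der L (A ∷ Γ) nothing → Der L Σ Δ
  rT□    : ∀ {Σ Γ A Δ} → Has L T□ → Σ ↭ (□ A ∷ Γ) →
           Der L (A ∷ □ A ∷ Γ) Δ → Der L Σ Δ
  rT◇    : ∀ {Γ A} → Has L T◇ → Der L Γ (just A) → Der L Γ (just (◇ A))
  rP□    : ∀ {Σ Γ A Δ} → Has L P□ → Σ ↭ (□ A ∷ Γ) →
           Der L (A ∷ []) nothing → Der L Σ Δ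
  rP◇    : ∀ {Γ A} → Has L P◇ → Der L [] (just A) → Der L Γ (just (◇ A))
  rD     : ∀ {Σ Γ A B} → Has L D → Σ ↭ (□ A ∷ Γ) →
           Der L (A ∷ []) (just B) → Der L Σ (just (◇ B))
  rD□    : ∀ {Σ Γ A B Δ} → Has L D□ → Σ ↭ (□ A ∷ □ B ∷ Γ) →
           Der L (A ∷ B ∷ []) nothing → Der L Σ Δ
  rCD    : ∀ {Σ Γ Γ' A} → Has L CD → Σ ↭ (□* Γ ++ Γ') →
           Der L Γ (just A) → Der L Σ (just (◇ A))
  rCD□   : ∀ {Σ Γ Γ' Δ} → Has L CD□ → Σ ↭ (□* Γ ++ Γ') →
           Der L Γ nothing → Der L Σ Δ

height : ∀ {L Γ Δ} → Der L Γ Δ → ℕ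
height (init _) = 0
height (L⊥ _) = 0
height (L→ _ d e) = suc (height d ⊔ height e)
height (R→ d) = suc (height d)
height (R∧ d e) = suc (height d ⊔ height e)
height (L∧ _ d) = suc (height d)
height (R∨₁ d) = suc (height d)
height (R∨₂ d) = suc (height d)
height (L∨ _ d e) = suc (height d ⊔ height e)
height (rM□ _ _ d) = suc (height d)
height (rM◇ _ _ d) = suc (height d)
height (rDualM _ _ d) = suc (height d)
height (rN□ _ d) = suc (height d)
height (rN◇ _ _ d) = suc (height d)
height (rC□ _ _ d) = suc (height d)
height (rC◇ _ _ d) = suc (height d)
height (rDualC _ _ d) = suc (height d)
height (rK□ _ _ d) = suc (height d)
height (rK◇ _ _ d) = suc (height d)
height (rDualK _ _ d) = suc (height d)
height (rT□ _ _ d) = suc (height d)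
height (rT◇ _ d) = suc (height d)
height (rP□ _ _ d) = suc (height d)
height (rP◇ _ d) = suc (height d)
height (rD _ _ d) = suc (height d)
height (rD□ _ _ d) = suc (height d)
height (rCD _ _ d) = suc (height d)
height (rCD□ _ _ d) = suc (height d)

HPLeftWeakening : Calc → Set
HPLeftWeakening L = ∀ (Γ : Ctx) (Δ : Succ) (A : Fm) (d : Der L Γ Δ) →
  Σ (Der L (A ∷ Γ) Δ) (λ d' → height d' ≤ height d)

HPRightWeakening : Calc → Set
HPRightWeakening L = ∀ (Γ : Ctx) (A : Fm) (d : Der L Γ nothing) →
  Σ (Der L Γ (just A)) (λ d' → height d' ≤ height d)

HPLeftContraction : Calc → Set
HPLeftContraction L = ∀ (Γ : Ctx) (Δ : Succ) (A : Fm) (d : Der L (A ∷ A ∷ Γ) Δ) →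
  Σ (Der L (A ∷ Γ) Δ) (λ d' → height d' ≤ height d)

-- Weakening is absorbed by the arbitrary side context Γ′ of initial sequents and modal
-- rules and is otherwise pushed into the premisses; right weakening only concerns rules
-- with empty succedent, whose succedent is arbitrary or inherited from a premiss. If one contracted copy is principal in
-- L∧, L∨ or L→, height-preserving invertibility (of the right premiss, for L→)
-- duplicates its immediate subformulas instead, which are contracted by induction.
-- If both copies are principal in a modal rule, they are side formulas □E of □Γ, so E is
-- contracted in the premiss; for D□ the two boxes coincide and P□ applies instead.
module Submission where

open import Data.Bool using (Bool; true; false; T)
open import Data.Bool.ListAction using (any)
open import Data.Empty using (⊥-elim)
open import Data.List using (List; []; _∷_; _++_)
open import Data.List.Membership.Propositional using (_∈_; _∉_)
open import Data.List.Membership.Propositional.Properties using (∈-∃++; ∈-++⁻; ∈-map⁻)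
open import Data.List.Relation.Binary.Permutation.Propositional using (_↭_; prep; swap; ↭-refl; ↭-sym; ↭-trans)
open import Data.List.Relation.Binary.Permutation.Propositional.Properties
  using (drop-∷; shift; shifts; ∈-resp-↭; ↭-length; ++⁺ˡ; ++⁺ʳ; ↭-singleton-inv; ↭-map-inv)
open import Data.List.Relation.Unary.All using (All; []; _∷_; lookup)
open import Data.List.Relation.Unary.Any as Any using (here; there)
open import Data.List.Relation.Unary.Any.Properties using (any⁺)
open import Data.Maybe using (just; nothing)
open import Data.Nat using (ℕ; suc; _≤_; s≤s)
open import Data.Nat.Properties using (⊔-lub; m⊔n≤o⇒m≤o; m⊔n≤o⇒n≤o; n≤1+n; ≤-refl; ≤-trans)
open import Data.Product using (Σ-syntax; ∃; ∃₂; _×_; _,_; proj₂)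
open import Data.Sum using (_⊎_; inj₁; inj₂)
open import Data.Unit using (tt)
open import Relation.Binary.PropositionalEquality using (_≡_; refl; subst)
open import Relation.Nullary using (¬_)

open import Defs

module _ {a} {A : Set a} where

  ∈⇒↭∷ : ∀ {x : A} {xs} → x ∈ xs → ∃ λ ys → xs ↭ x ∷ ys
  ∈⇒↭∷ x∈xs with ys , zs , refl ← ∈-∃++ x∈xs = ys ++ zs , shift _ ys zs

  ↭-shifts : ∀ ws xs {ys zs : List A} → ys ↭ xs ++ zs → ws ++ ys ↭ xs ++ ws ++ zs
  ↭-shifts ws xs p = ↭-trans (++⁺ˡ ws p) (shifts ws xs)

  ∷↭++-inv : ∀ {x : A} {ys} xs {zs} → x ∷ ys ↭ xs ++ zs →
             (∃ λ xs′ → xs ↭ x ∷ xs′ × ys ↭ xs′ ++ zs) ⊎ (∃ λ zs′ → zs ↭ x ∷ zs′ × ys ↭ xs ++ zs′)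
  ∷↭++-inv {x} xs {zs} p with ∈-++⁻ xs (∈-resp-↭ p (here refl))
  ... | inj₁ x∈xs = let xs′ , xs↭ = ∈⇒↭∷ x∈xs in
    inj₁ (xs′ , xs↭ , drop-∷ (↭-trans p (++⁺ʳ zs xs↭)))
  ... | inj₂ x∈zs = let zs′ , zs↭ = ∈⇒↭∷ x∈zs in
    inj₂ (zs′ , zs↭ , drop-∷ (↭-trans p (↭-trans (++⁺ˡ xs zs↭) (shift x xs zs′))))

  ∷↭∷-inv : ∀ {x y : A} {xs ys} → x ∷ xs ↭ y ∷ ys →
            (x ≡ y × xs ↭ ys) ⊎ (∃ λ zs → xs ↭ y ∷ zs × ys ↭ x ∷ zs)
  ∷↭∷-inv p with ∷↭++-inv (_ ∷ []) p
  ... | inj₁ (_ , y↭ , xs↭) with refl ← ↭-singleton-inv (↭-sym y↭) = inj₁ (refl , xs↭)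
  ... | inj₂ (zs , ys↭ , xs↭) = inj₂ (zs , xs↭ , ys↭)

  ∷∷↭∷-inv : ∀ {c x : A} {ys zs} → c ∷ c ∷ ys ↭ x ∷ zs →
             (∃ λ ws → zs ↭ c ∷ c ∷ ws × c ∷ ys ↭ x ∷ c ∷ ws) ⊎ (x ≡ c × zs ↭ c ∷ ys)
  ∷∷↭∷-inv {c} {x} p with ∷↭∷-inv p
  ... | inj₁ (refl , cys↭) = inj₂ (refl , ↭-sym cys↭)
  ... | inj₂ (ws , cys↭ , zs↭) with ∷↭∷-inv cys↭
  ...   | inj₁ (refl , ys↭) = inj₂ (refl , ↭-trans zs↭ (prep c (↭-sym ys↭)))
  ...   | inj₂ (ws′ , ys↭ , ws↭) =
    inj₁ (ws′ , ↭-trans zs↭ (prep c ws↭) , ↭-trans (prep c ys↭) (swap c x ↭-refl))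

  ∷∷↭∷⇒∷↭∷ : ∀ {c x : A} {ys zs} → c ∷ c ∷ ys ↭ x ∷ zs → ∃ λ zs′ → c ∷ ys ↭ x ∷ zs′
  ∷∷↭∷⇒∷↭∷ p with ∷∷↭∷-inv p
  ... | inj₁ (ws , _ , cys↭) = _ ∷ ws , cys↭
  ... | inj₂ (refl , _) = _ , ↭-refl

  ∷∷↭++-inv : ∀ {c : A} {ys} xs {zs} → c ∷ c ∷ ys ↭ xs ++ zs →
              (∃ λ xs′ → xs ↭ c ∷ c ∷ xs′ × ys ↭ xs′ ++ zs) ⊎ (∃ λ zs′ → c ∷ ys ↭ xs ++ zs′)
  ∷∷↭++-inv {c} xs p with ∷↭++-inv xs p
  ... | inj₂ (zs′ , _ , cys↭) = inj₂ (zs′ , cys↭)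
  ... | inj₁ (xs₁ , xs↭ , cys↭) with ∷↭++-inv xs₁ cys↭
  ...   | inj₁ (xs′ , xs₁↭ , ys↭) = inj₁ (xs′ , ↭-trans xs↭ (prep c xs₁↭) , ys↭)
  ...   | inj₂ (zs′ , _ , ys↭) = inj₂ (zs′ , ↭-trans (prep c ys↭) (↭-sym (++⁺ʳ zs′ xs↭)))

  ∷↭∷∷-inv : ∀ {x c : A} {ys zs} → x ∉ ys → x ∷ ys ↭ c ∷ c ∷ zs →
             ∃ λ zs′ → ys ↭ c ∷ c ∷ zs′ × zs ↭ x ∷ zs′
  ∷↭∷∷-inv x∉ys p with ∷↭∷-inv p
  ... | inj₁ (refl , ys↭) = ⊥-elim (x∉ys (∈-resp-↭ (↭-sym ys↭) (here refl)))
  ... | inj₂ (ws , ys↭ , czs↭) with ∷↭∷-inv czs↭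
  ...   | inj₁ (refl , _) = ⊥-elim (x∉ys (∈-resp-↭ (↭-sym ys↭) (here refl)))
  ...   | inj₂ (zs′ , zs↭ , ws↭) = zs′ , ↭-trans ys↭ (prep _ ws↭) , zs↭

  [x,y]↭∷∷-inv : ∀ {x y c : A} {zs} → x ∷ y ∷ [] ↭ c ∷ c ∷ zs → x ≡ c × y ≡ c × zs ≡ []
  [x,y]↭∷∷-inv {zs = _ ∷ _} p with () ← ↭-length p
  [x,y]↭∷∷-inv {zs = []} p with ∷↭∷-inv p
  ... | inj₁ (refl , y↭) with refl ← ↭-singleton-inv y↭ = refl , refl , refl
  ... | inj₂ (_ , y↭ , c↭) with ↭-singleton-inv (↭-sym c↭)
  ...   | refl with ↭-singleton-inv y↭
  ...     | refl = refl , refl , refl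

data PropAtomic : Fm → Set where
  atomic  : ∀ {p} → PropAtomic (atom p)
  falsum  : PropAtomic ⊥f
  boxed   : ∀ {A} → PropAtomic (□ A)
  diamond : ∀ {A} → PropAtomic (◇ A)

data PropCompound : Fm → Set where
  conj : ∀ {A B} → PropCompound (A ∧ B)
  disj : ∀ {A B} → PropCompound (A ∨ B)
  impl : ∀ {A B} → PropCompound (A ⇒f B)

compound⇒¬atomic : ∀ {F} → PropCompound F → ¬ PropAtomic F
compound⇒¬atomic conj ()
compound⇒¬atomic disj ()
compound⇒¬atomic impl ()

□*-atomic : ∀ Γ → All PropAtomic (□* Γ)
□*-atomic []      = []
□*-atomic (_ ∷ Γ) = boxed ∷ □*-atomic Γ

-- Initial sequents and modal rules conclude Q ++ Γ′ for an arbitrary side context Γ′; their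
-- anchor Q consists of PropAtomic formulas, so a formula to be inverted lies in Γ′.
compound∉anchor : ∀ {F Γ Γ′} {Q : Ctx} → PropCompound F → All PropAtomic Q →
                  F ∷ Γ ↭ Q ++ Γ′ → ∃ λ R → Γ ↭ Q ++ R
compound∉anchor {Q = Q} F-compound atomics p with ∷↭++-inv Q p
... | inj₁ (_ , Q↭ , _) =
  ⊥-elim (compound⇒¬atomic F-compound (lookup atomics (∈-resp-↭ (↭-sym Q↭) (here refl))))
... | inj₂ (R , _ , Γ↭) = R , Γ↭

◇∉□* : ∀ {A} Γ → ◇ A ∉ □* Γ
◇∉□* Γ ◇A∈ with ∈-map⁻ □_ ◇A∈
... | _ , _ , ()

□*↭∷∷-inv : ∀ Γ {C Q} → □* Γ ↭ C ∷ C ∷ Q →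
            ∃₂ λ E Γ₀ → C ≡ □ E × Γ ↭ E ∷ E ∷ Γ₀ × Q ≡ □* Γ₀
□*↭∷∷-inv Γ p with ↭-map-inv □_ p
... | E ∷ _ ∷ Γ₀ , refl , Γ↭ = E , Γ₀ , refl , Γ↭ , refl

◇□*↭∷∷-inv : ∀ Γ {A C Q} → ◇ A ∷ □* Γ ↭ C ∷ C ∷ Q →
             ∃₂ λ E Γ₀ → C ≡ □ E × Γ ↭ E ∷ E ∷ Γ₀ × C ∷ Q ↭ ◇ A ∷ □* (E ∷ Γ₀)
◇□*↭∷∷-inv Γ {A} p with ∷↭∷∷-inv (◇∉□* Γ) p
... | _ , boxes , Q↭ with □*↭∷∷-inv Γ boxes
...   | E , Γ₀ , refl , Γ↭ , refl =
  E , Γ₀ , refl , Γ↭ , ↭-trans (prep (□ E) Q↭) (swap (□ E) (◇ A) ↭-refl)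

isD□ : MRule → Bool
isD□ D□ = true
isD□ _  = false

P□-in-D□-calculi : ∀ L → T (any isD□ (rulesOf L)) → Has L P□
P□-in-D□-calculi WMD  _ = there (there (there (there (there (here refl)))))
P□-in-D□-calculi WMND _ = there (there (there (there (there (there (there (here refl)))))))
P□-in-D□-calculi WM   ()
P□-in-D□-calculi WMP  ()
P□-in-D□-calculi WMN  ()
P□-in-D□-calculi WMNP ()
P□-in-D□-calculi WMC  ()
P□-in-D□-calculi WK   ()
P□-in-D□-calculi WMCD ()
P□-in-D□-calculi WKD  ()
P□-in-D□-calculi WMT  ()
P□-in-D□-calculi WMNT ()
P□-in-D□-calculi WMCT ()
P□-in-D□-calculi WKT  ()

has-D□⇒has-P□ : ∀ {L} → Has L D□ → Has L P□
has-D□⇒has-P□ {L} D□∈ = P□-in-D□-calculi L (any⁺ isD□ (Any.map (λ { refl → tt }) D□∈))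

module _ {L : Calc} where

  Der≤ : Ctx → Succ → ℕ → Set
  Der≤ Γ Δ n = Σ[ d ∈ Der L Γ Δ ] height d ≤ n

  exchange : ∀ {Γ Γ′ Δ n} → Γ′ ↭ Γ → Der≤ Γ Δ n → Der≤ Γ′ Δ n
  exchange r (init q , h) = init (↭-trans r q) , h
  exchange r (L⊥ q , h) = L⊥ (↭-trans r q) , h
  exchange r (L→ q d e , h) = L→ (↭-trans r q) d e , h
  exchange r (R→ d , s≤s h) = let d′ , h′ = exchange (prep _ r) (d , h) in R→ d′ , s≤s h′
  exchange r (R∧ d e , s≤s h) =
    let d′ , h₁ = exchange r (d , m⊔n≤o⇒m≤o _ _ h)
        e′ , h₂ = exchange r (e , m⊔n≤o⇒n≤o _ _ h)
    in R∧ d′ e′ , s≤s (⊔-lub h₁ h₂)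
  exchange r (L∧ q d , h) = L∧ (↭-trans r q) d , h
  exchange r (R∨₁ d , s≤s h) = let d′ , h′ = exchange r (d , h) in R∨₁ d′ , s≤s h′
  exchange r (R∨₂ d , s≤s h) = let d′ , h′ = exchange r (d , h) in R∨₂ d′ , s≤s h′
  exchange r (L∨ q d e , h) = L∨ (↭-trans r q) d e , h
  exchange r (rM□ m q d , h) = rM□ m (↭-trans r q) d , h
  exchange r (rM◇ m q d , h) = rM◇ m (↭-trans r q) d , h
  exchange r (rDualM m q d , h) = rDualM m (↭-trans r q) d , h
  exchange r (rN□ m d , h) = rN□ m d , h
  exchange r (rN◇ m q d , h) = rN◇ m (↭-trans r q) d , h
  exchange r (rC□ m q d , h) = rC□ m (↭-trans r q) d , h
  exchange r (rC◇ m q d , h) = rC◇ m (↭-trans r q) d , h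
  exchange r (rDualC m q d , h) = rDualC m (↭-trans r q) d , h
  exchange r (rK□ m q d , h) = rK□ m (↭-trans r q) d , h
  exchange r (rK◇ m q d , h) = rK◇ m (↭-trans r q) d , h
  exchange r (rDualK m q d , h) = rDualK m (↭-trans r q) d , h
  exchange r (rT□ m q d , h) = rT□ m (↭-trans r q) d , h
  exchange r (rT◇ m d , s≤s h) = let d′ , h′ = exchange r (d , h) in rT◇ m d′ , s≤s h′
  exchange r (rP□ m q d , h) = rP□ m (↭-trans r q) d , h
  exchange r (rP◇ m d , h) = rP◇ m d , h
  exchange r (rD m q d , h) = rD m (↭-trans r q) d , h
  exchange r (rD□ m q d , h) = rD□ m (↭-trans r q) d , h
  exchange r (rCD m q d , h) = rCD m (↭-trans r q) d , h
  exchange r (rCD□ m q d , h) = rCD□ m (↭-trans r q) d , h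

  weakenˡ : ∀ {Γ Δ n} A → Der≤ Γ Δ n → Der≤ (A ∷ Γ) Δ n
  weakenˡ-under : ∀ {Γ Δ n} Θ A → Der≤ (Θ ++ Γ) Δ n → Der≤ (Θ ++ A ∷ Γ) Δ n
  weakenˡ-under Θ A d = exchange (↭-sym (shifts (A ∷ []) Θ)) (weakenˡ A d)

  weakenˡ A (init {p = p} q , h) = init (↭-shifts (A ∷ []) (atom p ∷ []) q) , h
  weakenˡ A (L⊥ q , h) = L⊥ (↭-shifts (A ∷ []) (⊥f ∷ []) q) , h
  weakenˡ A (L→ {A = X} {B = Y} q d e , s≤s h) =
    let d′ , h₁ = weakenˡ-under (X ⇒f Y ∷ []) A (d , m⊔n≤o⇒m≤o _ _ h)
        e′ , h₂ = weakenˡ-under (Y ∷ []) A (e , m⊔n≤o⇒n≤o _ _ h)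
    in L→ (↭-shifts (A ∷ []) (X ⇒f Y ∷ []) q) d′ e′ , s≤s (⊔-lub h₁ h₂)
  weakenˡ A (R→ {A = X} d , s≤s h) =
    let d′ , h′ = weakenˡ-under (X ∷ []) A (d , h) in R→ d′ , s≤s h′
  weakenˡ A (R∧ d e , s≤s h) =
    let d′ , h₁ = weakenˡ A (d , m⊔n≤o⇒m≤o _ _ h)
        e′ , h₂ = weakenˡ A (e , m⊔n≤o⇒n≤o _ _ h)
    in R∧ d′ e′ , s≤s (⊔-lub h₁ h₂)
  weakenˡ A (L∧ {A = X} {B = Y} q d , s≤s h) =
    let d′ , h′ = weakenˡ-under (X ∷ Y ∷ []) A (d , h)
    in L∧ (↭-shifts (A ∷ []) (X ∧ Y ∷ []) q) d′ , s≤s h′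
  weakenˡ A (R∨₁ d , s≤s h) = let d′ , h′ = weakenˡ A (d , h) in R∨₁ d′ , s≤s h′
  weakenˡ A (R∨₂ d , s≤s h) = let d′ , h′ = weakenˡ A (d , h) in R∨₂ d′ , s≤s h′
  weakenˡ A (L∨ {A = X} {B = Y} q d e , s≤s h) =
    let d′ , h₁ = weakenˡ-under (X ∷ []) A (d , m⊔n≤o⇒m≤o _ _ h)
        e′ , h₂ = weakenˡ-under (Y ∷ []) A (e , m⊔n≤o⇒n≤o _ _ h)
    in L∨ (↭-shifts (A ∷ []) (X ∨ Y ∷ []) q) d′ e′ , s≤s (⊔-lub h₁ h₂)
  weakenˡ A (rM□ {A = X} m q d , h) = rM□ m (↭-shifts (A ∷ []) (□ X ∷ []) q) d , h
  weakenˡ A (rM◇ {A = X} m q d , h) = rM◇ m (↭-shifts (A ∷ []) (◇ X ∷ []) q) d , h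
  weakenˡ A (rDualM {A = X} {B = Y} m q d , h) =
    rDualM m (↭-shifts (A ∷ []) (□ X ∷ ◇ Y ∷ []) q) d , h
  weakenˡ A (rN□ m d , h) = rN□ m d , h
  weakenˡ A (rN◇ {A = X} m q d , h) = rN◇ m (↭-shifts (A ∷ []) (◇ X ∷ []) q) d , h
  weakenˡ A (rC□ {Γ = G} {A = X} m q d , h) = rC□ m (↭-shifts (A ∷ []) (□ X ∷ □* G) q) d , h
  weakenˡ A (rC◇ {Γ = G} {A = X} m q d , h) = rC◇ m (↭-shifts (A ∷ []) (◇ X ∷ □* G) q) d , h
  weakenˡ A (rDualC {Γ = G} {A = X} {B = Y} m q d , h) =
    rDualC m (↭-shifts (A ∷ []) (□ X ∷ ◇ Y ∷ □* G) q) d , h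
  weakenˡ A (rK□ {Γ = G} m q d , h) = rK□ m (↭-shifts (A ∷ []) (□* G) q) d , h
  weakenˡ A (rK◇ {Γ = G} {A = X} m q d , h) = rK◇ m (↭-shifts (A ∷ []) (◇ X ∷ □* G) q) d , h
  weakenˡ A (rDualK {Γ = G} {A = X} m q d , h) =
    rDualK m (↭-shifts (A ∷ []) (◇ X ∷ □* G) q) d , h
  weakenˡ A (rT□ {A = X} m q d , s≤s h) =
    let d′ , h′ = weakenˡ-under (X ∷ □ X ∷ []) A (d , h)
    in rT□ m (↭-shifts (A ∷ []) (□ X ∷ []) q) d′ , s≤s h′
  weakenˡ A (rT◇ m d , s≤s h) = let d′ , h′ = weakenˡ A (d , h) in rT◇ m d′ , s≤s h′
  weakenˡ A (rP□ {A = X} m q d , h) = rP□ m (↭-shifts (A ∷ []) (□ X ∷ []) q) d , h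
  weakenˡ A (rP◇ m d , h) = rP◇ m d , h
  weakenˡ A (rD {A = X} m q d , h) = rD m (↭-shifts (A ∷ []) (□ X ∷ []) q) d , h
  weakenˡ A (rD□ {A = X} {B = Y} m q d , h) =
    rD□ m (↭-shifts (A ∷ []) (□ X ∷ □ Y ∷ []) q) d , h
  weakenˡ A (rCD {Γ = G} m q d , h) = rCD m (↭-shifts (A ∷ []) (□* G) q) d , h
  weakenˡ A (rCD□ {Γ = G} m q d , h) = rCD□ m (↭-shifts (A ∷ []) (□* G) q) d , h

  weakenʳ : ∀ {Γ n} A → Der≤ Γ nothing n → Der≤ Γ (just A) n
  weakenʳ A (L⊥ q , h) = L⊥ q , h
  weakenʳ A (L→ q d e , s≤s h) =
    let e′ , h′ = weakenʳ A (e , m⊔n≤o⇒n≤o _ _ h) in L→ q d e′ , s≤s (⊔-lub (m⊔n≤o⇒m≤o _ _ h) h′)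
  weakenʳ A (L∧ q d , s≤s h) = let d′ , h′ = weakenʳ A (d , h) in L∧ q d′ , s≤s h′
  weakenʳ A (L∨ q d e , s≤s h) =
    let d′ , h₁ = weakenʳ A (d , m⊔n≤o⇒m≤o _ _ h)
        e′ , h₂ = weakenʳ A (e , m⊔n≤o⇒n≤o _ _ h)
    in L∨ q d′ e′ , s≤s (⊔-lub h₁ h₂)
  weakenʳ A (rDualM m q d , h) = rDualM m q d , h
  weakenʳ A (rN◇ m q d , h) = rN◇ m q d , h
  weakenʳ A (rDualC m q d , h) = rDualC m q d , h
  weakenʳ A (rDualK m q d , h) = rDualK m q d , h
  weakenʳ A (rT□ m q d , s≤s h) = let d′ , h′ = weakenʳ A (d , h) in rT□ m q d′ , s≤s h′
  weakenʳ A (rP□ m q d , h) = rP□ m q d , h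
  weakenʳ A (rD□ m q d , h) = rD□ m q d , h
  weakenʳ A (rCD□ m q d , h) = rCD□ m q d , h

  Der≤-step : ∀ {Γ Δ n} → Der≤ Γ Δ n → Der≤ Γ Δ (suc n)
  Der≤-step (d , h) = d , ≤-trans h (n≤1+n _)

  -- What inverting F does when F is principal; all other cases are uniform in F.
  record PrincipalCases (F : Fm) (Ψ : Ctx) : Set where
    field
      L∧-case : ∀ {A B Γ Δ n} → A ∧ B ≡ F → Der≤ (A ∷ B ∷ Γ) Δ n → Der≤ (Ψ ++ Γ) Δ n
      L∨-case : ∀ {A B Γ Δ n} → A ∨ B ≡ F →
                Der≤ (A ∷ Γ) Δ n → Der≤ (B ∷ Γ) Δ n → Der≤ (Ψ ++ Γ) Δ n
      L→-case : ∀ {A B Γ Δ n} → A ⇒f B ≡ F →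
                Der≤ (A ⇒f B ∷ Γ) (just A) n → Der≤ (B ∷ Γ) Δ n → Der≤ (Ψ ++ Γ) Δ n

  module Inversion {F : Fm} (Ψ : Ctx) (F-compound : PropCompound F) (principal : PrincipalCases F Ψ) where
    open PrincipalCases principal

    reanchor : ∀ {Γ₀ Γ Γ′} Q → All PropAtomic Q → Γ₀ ↭ Q ++ Γ′ → Γ₀ ↭ F ∷ Γ → ∃ λ R → Ψ ++ Γ ↭ Q ++ R
    reanchor Q atomics q p =
      let R , Γ↭ = compound∉anchor F-compound atomics (↭-trans (↭-sym p) q)
      in Ψ ++ R , ↭-shifts Ψ Q Γ↭

    invert : ∀ {Γ₀ Γ Δ n} → Der≤ Γ₀ Δ n → Γ₀ ↭ F ∷ Γ → Der≤ (Ψ ++ Γ) Δ n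
    invert-under : ∀ {G Γ Δ n} Θ → Der≤ (Θ ++ G) Δ n → G ↭ F ∷ Γ → Der≤ (Θ ++ Ψ ++ Γ) Δ n
    invert-under Θ d g = exchange (↭-sym (shifts Ψ Θ)) (invert d (↭-shifts Θ (F ∷ []) g))

    invert (init {p = p} q , h) r = init (proj₂ (reanchor (atom p ∷ []) (atomic ∷ []) q r)) , h
    invert (L⊥ q , h) r = L⊥ (proj₂ (reanchor (⊥f ∷ []) (falsum ∷ []) q r)) , h
    invert (L→ {A = X} {B = Y} q d e , s≤s h) r with ∷↭∷-inv (↭-trans (↭-sym q) r)
    ... | inj₁ (X⇒Y≡F , g) = Der≤-step (L→-case X⇒Y≡F (exchange (prep _ (↭-sym g)) (d , m⊔n≤o⇒m≤o _ _ h))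
                                                    (exchange (prep _ (↭-sym g)) (e , m⊔n≤o⇒n≤o _ _ h)))
    ... | inj₂ (R , g , Γ↭) =
      let d′ , h₁ = invert-under (X ⇒f Y ∷ []) (d , m⊔n≤o⇒m≤o _ _ h) g
          e′ , h₂ = invert-under (Y ∷ []) (e , m⊔n≤o⇒n≤o _ _ h) g
      in L→ (↭-shifts Ψ (X ⇒f Y ∷ []) Γ↭) d′ e′ , s≤s (⊔-lub h₁ h₂)
    invert (R→ {A = X} d , s≤s h) r =
      let d′ , h′ = invert-under (X ∷ []) (d , h) r in R→ d′ , s≤s h′
    invert (R∧ d e , s≤s h) r =
      let d′ , h₁ = invert (d , m⊔n≤o⇒m≤o _ _ h) r
          e′ , h₂ = invert (e , m⊔n≤o⇒n≤o _ _ h) r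
      in R∧ d′ e′ , s≤s (⊔-lub h₁ h₂)
    invert (L∧ {A = X} {B = Y} q d , s≤s h) r with ∷↭∷-inv (↭-trans (↭-sym q) r)
    ... | inj₁ (X∧Y≡F , g) = Der≤-step (L∧-case X∧Y≡F (exchange (++⁺ˡ (X ∷ Y ∷ []) (↭-sym g)) (d , h)))
    ... | inj₂ (R , g , Γ↭) =
      let d′ , h′ = invert-under (X ∷ Y ∷ []) (d , h) g
      in L∧ (↭-shifts Ψ (X ∧ Y ∷ []) Γ↭) d′ , s≤s h′
    invert (R∨₁ d , s≤s h) r = let d′ , h′ = invert (d , h) r in R∨₁ d′ , s≤s h′
    invert (R∨₂ d , s≤s h) r = let d′ , h′ = invert (d , h) r in R∨₂ d′ , s≤s h′
    invert (L∨ {A = X} {B = Y} q d e , s≤s h) r with ∷↭∷-inv (↭-trans (↭-sym q) r)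
    ... | inj₁ (X∨Y≡F , g) = Der≤-step (L∨-case X∨Y≡F (exchange (prep _ (↭-sym g)) (d , m⊔n≤o⇒m≤o _ _ h))
                                                    (exchange (prep _ (↭-sym g)) (e , m⊔n≤o⇒n≤o _ _ h)))
    ... | inj₂ (R , g , Γ↭) =
      let d′ , h₁ = invert-under (X ∷ []) (d , m⊔n≤o⇒m≤o _ _ h) g
          e′ , h₂ = invert-under (Y ∷ []) (e , m⊔n≤o⇒n≤o _ _ h) g
      in L∨ (↭-shifts Ψ (X ∨ Y ∷ []) Γ↭) d′ e′ , s≤s (⊔-lub h₁ h₂)
    invert (rM□ {A = X} m q d , h) r = rM□ m (proj₂ (reanchor (□ X ∷ []) (boxed ∷ []) q r)) d , h
    invert (rM◇ {A = X} m q d , h) r = rM◇ m (proj₂ (reanchor (◇ X ∷ []) (diamond ∷ []) q r)) d , h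
    invert (rDualM {A = X} {B = Y} m q d , h) r =
      rDualM m (proj₂ (reanchor (□ X ∷ ◇ Y ∷ []) (boxed ∷ diamond ∷ []) q r)) d , h
    invert (rN□ m d , h) r = rN□ m d , h
    invert (rN◇ {A = X} m q d , h) r = rN◇ m (proj₂ (reanchor (◇ X ∷ []) (diamond ∷ []) q r)) d , h
    invert (rC□ {Γ = G} {A = X} m q d , h) r =
      rC□ m (proj₂ (reanchor (□* (X ∷ G)) (□*-atomic (X ∷ G)) q r)) d , h
    invert (rC◇ {Γ = G} {A = X} m q d , h) r =
      rC◇ m (proj₂ (reanchor (◇ X ∷ □* G) (diamond ∷ □*-atomic G) q r)) d , h
    invert (rDualC {Γ = G} {A = X} {B = Y} m q d , h) r =
      rDualC m (proj₂ (reanchor (□ X ∷ ◇ Y ∷ □* G) (boxed ∷ diamond ∷ □*-atomic G) q r)) d , h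
    invert (rK□ {Γ = G} m q d , h) r = rK□ m (proj₂ (reanchor (□* G) (□*-atomic G) q r)) d , h
    invert (rK◇ {Γ = G} {A = X} m q d , h) r =
      rK◇ m (proj₂ (reanchor (◇ X ∷ □* G) (diamond ∷ □*-atomic G) q r)) d , h
    invert (rDualK {Γ = G} {A = X} m q d , h) r =
      rDualK m (proj₂ (reanchor (◇ X ∷ □* G) (diamond ∷ □*-atomic G) q r)) d , h
    invert (rT□ {A = X} m q d , s≤s h) r with ∷↭∷-inv (↭-trans (↭-sym q) r)
    ... | inj₁ (□X≡F , _) = ⊥-elim (compound⇒¬atomic F-compound (subst PropAtomic □X≡F boxed))
    ... | inj₂ (R , g , Γ↭) =
      let d′ , h′ = invert-under (X ∷ □ X ∷ []) (d , h) g
      in rT□ m (↭-shifts Ψ (□ X ∷ []) Γ↭) d′ , s≤s h′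
    invert (rT◇ m d , s≤s h) r = let d′ , h′ = invert (d , h) r in rT◇ m d′ , s≤s h′
    invert (rP□ {A = X} m q d , h) r = rP□ m (proj₂ (reanchor (□ X ∷ []) (boxed ∷ []) q r)) d , h
    invert (rP◇ m d , h) r = rP◇ m d , h
    invert (rD {A = X} m q d , h) r = rD m (proj₂ (reanchor (□ X ∷ []) (boxed ∷ []) q r)) d , h
    invert (rD□ {A = X} {B = Y} m q d , h) r =
      rD□ m (proj₂ (reanchor (□ X ∷ □ Y ∷ []) (boxed ∷ boxed ∷ []) q r)) d , h
    invert (rCD {Γ = G} m q d , h) r = rCD m (proj₂ (reanchor (□* G) (□*-atomic G) q r)) d , h
    invert (rCD□ {Γ = G} m q d , h) r = rCD□ m (proj₂ (reanchor (□* G) (□*-atomic G) q r)) d , h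

  ∧-principal : ∀ {A B} → PrincipalCases (A ∧ B) (A ∷ B ∷ [])
  ∧-principal = record { L∧-case = λ { refl d → d } ; L∨-case = λ () ; L→-case = λ () }

  ∨ˡ-principal : ∀ {A B} → PrincipalCases (A ∨ B) (A ∷ [])
  ∨ˡ-principal = record { L∧-case = λ () ; L∨-case = λ { refl d _ → d } ; L→-case = λ () }

  ∨ʳ-principal : ∀ {A B} → PrincipalCases (A ∨ B) (B ∷ [])
  ∨ʳ-principal = record { L∧-case = λ () ; L∨-case = λ { refl _ e → e } ; L→-case = λ () }

  →ʳ-principal : ∀ {A B} → PrincipalCases (A ⇒f B) (B ∷ [])
  →ʳ-principal = record { L∧-case = λ () ; L∨-case = λ () ; L→-case = λ { refl _ e → e } }

  invert-∧ : ∀ {Γ₀ Γ Δ n A B} → Der≤ Γ₀ Δ n → Γ₀ ↭ A ∧ B ∷ Γ → Der≤ (A ∷ B ∷ Γ) Δ n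
  invert-∧ {A = A} {B} = Inversion.invert (A ∷ B ∷ []) conj ∧-principal

  invert-∨ˡ : ∀ {Γ₀ Γ Δ n A B} → Der≤ Γ₀ Δ n → Γ₀ ↭ A ∨ B ∷ Γ → Der≤ (A ∷ Γ) Δ n
  invert-∨ˡ {A = A} = Inversion.invert (A ∷ []) disj ∨ˡ-principal

  invert-∨ʳ : ∀ {Γ₀ Γ Δ n A B} → Der≤ Γ₀ Δ n → Γ₀ ↭ A ∨ B ∷ Γ → Der≤ (B ∷ Γ) Δ n
  invert-∨ʳ {B = B} = Inversion.invert (B ∷ []) disj ∨ʳ-principal

  invert-→ʳ : ∀ {Γ₀ Γ Δ n A B} → Der≤ Γ₀ Δ n → Γ₀ ↭ A ⇒f B ∷ Γ → Der≤ (B ∷ Γ) Δ n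
  invert-→ʳ {B = B} = Inversion.invert (B ∷ []) impl →ʳ-principal

  -- Recursion is on the height bound n: the principal cases contract derivations
  -- obtained by inversion, which are not subderivations.
  contractˡ : ∀ {Γ₀ Γ Δ n C} → Der≤ Γ₀ Δ n → Γ₀ ↭ C ∷ C ∷ Γ → Der≤ (C ∷ Γ) Δ n
  contractˡ-under : ∀ {G Γ Δ n C} Θ → Der≤ (Θ ++ G) Δ n → G ↭ C ∷ C ∷ Γ → Der≤ (Θ ++ C ∷ Γ) Δ n
  contractˡ-under {C = C} Θ d g =
    exchange (↭-sym (shifts (C ∷ []) Θ)) (contractˡ d (↭-shifts Θ (C ∷ C ∷ []) g))

  contractˡ (init q , h) p = init (proj₂ (∷∷↭∷⇒∷↭∷ (↭-trans (↭-sym p) q))) , h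
  contractˡ (L⊥ q , h) p = L⊥ (proj₂ (∷∷↭∷⇒∷↭∷ (↭-trans (↭-sym p) q))) , h
  contractˡ (L→ {A = X} {B = Y} q d e , s≤s h) p with ∷∷↭∷-inv (↭-trans (↭-sym p) q)
  ... | inj₁ (_ , g , Γ↭) =
    let d′ , h₁ = contractˡ-under (X ⇒f Y ∷ []) (d , m⊔n≤o⇒m≤o _ _ h) g
        e′ , h₂ = contractˡ-under (Y ∷ []) (e , m⊔n≤o⇒n≤o _ _ h) g
    in L→ Γ↭ d′ e′ , s≤s (⊔-lub h₁ h₂)
  ... | inj₂ (refl , g) =
    let d′ , h₁ = contractˡ (d , m⊔n≤o⇒m≤o _ _ h) (prep _ g)
        e₁ = invert-→ʳ (e , m⊔n≤o⇒n≤o _ _ h) (↭-shifts (Y ∷ []) (X ⇒f Y ∷ []) g)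
        e′ , h₂ = contractˡ e₁ ↭-refl
    in L→ ↭-refl d′ e′ , s≤s (⊔-lub h₁ h₂)
  contractˡ (R→ {A = X} d , s≤s h) p =
    let d′ , h′ = contractˡ-under (X ∷ []) (d , h) p in R→ d′ , s≤s h′
  contractˡ (R∧ d e , s≤s h) p =
    let d′ , h₁ = contractˡ (d , m⊔n≤o⇒m≤o _ _ h) p
        e′ , h₂ = contractˡ (e , m⊔n≤o⇒n≤o _ _ h) p
    in R∧ d′ e′ , s≤s (⊔-lub h₁ h₂)
  contractˡ (L∧ {A = X} {B = Y} q d , s≤s h) p with ∷∷↭∷-inv (↭-trans (↭-sym p) q)
  ... | inj₁ (_ , g , Γ↭) =
    let d′ , h′ = contractˡ-under (X ∷ Y ∷ []) (d , h) g in L∧ Γ↭ d′ , s≤s h′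
  ... | inj₂ (refl , g) =
    let d₁ = invert-∧ (d , h) (↭-shifts (X ∷ Y ∷ []) (X ∧ Y ∷ []) g)
        d₂ = contractˡ d₁ (prep X (swap Y X ↭-refl))
        d′ , h′ = contractˡ-under (X ∷ []) d₂ ↭-refl
    in L∧ ↭-refl d′ , s≤s h′
  contractˡ (R∨₁ d , s≤s h) p = let d′ , h′ = contractˡ (d , h) p in R∨₁ d′ , s≤s h′
  contractˡ (R∨₂ d , s≤s h) p = let d′ , h′ = contractˡ (d , h) p in R∨₂ d′ , s≤s h′
  contractˡ (L∨ {A = X} {B = Y} q d e , s≤s h) p with ∷∷↭∷-inv (↭-trans (↭-sym p) q)
  ... | inj₁ (_ , g , Γ↭) =
    let d′ , h₁ = contractˡ-under (X ∷ []) (d , m⊔n≤o⇒m≤o _ _ h) g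
        e′ , h₂ = contractˡ-under (Y ∷ []) (e , m⊔n≤o⇒n≤o _ _ h) g
    in L∨ Γ↭ d′ e′ , s≤s (⊔-lub h₁ h₂)
  ... | inj₂ (refl , g) =
    let d′ , h₁ = contractˡ (invert-∨ˡ (d , m⊔n≤o⇒m≤o _ _ h) (↭-shifts (X ∷ []) (X ∨ Y ∷ []) g)) ↭-refl
        e′ , h₂ = contractˡ (invert-∨ʳ (e , m⊔n≤o⇒n≤o _ _ h) (↭-shifts (Y ∷ []) (X ∨ Y ∷ []) g)) ↭-refl
    in L∨ ↭-refl d′ e′ , s≤s (⊔-lub h₁ h₂)
  contractˡ (rM□ m q d , h) p = rM□ m (proj₂ (∷∷↭∷⇒∷↭∷ (↭-trans (↭-sym p) q))) d , h
  contractˡ (rM◇ m q d , h) p = rM◇ m (proj₂ (∷∷↭∷⇒∷↭∷ (↭-trans (↭-sym p) q))) d , h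
  contractˡ (rDualM {A = X} {B = Y} m q d , h) p with ∷∷↭++-inv (□ X ∷ ◇ Y ∷ []) (↭-trans (↭-sym p) q)
  ... | inj₁ (_ , dup , _) with refl , () , _ ← [x,y]↭∷∷-inv dup
  ... | inj₂ (_ , r) = rDualM m r d , h
  contractˡ (rN□ m d , h) p = rN□ m d , h
  contractˡ (rN◇ m q d , h) p = rN◇ m (proj₂ (∷∷↭∷⇒∷↭∷ (↭-trans (↭-sym p) q))) d , h
  contractˡ (rC□ {Γ = G} {A = X} m q d , s≤s h) p with ∷∷↭++-inv (□* (X ∷ G)) (↭-trans (↭-sym p) q)
  ... | inj₂ (_ , r) = rC□ m r d , s≤s h
  ... | inj₁ (_ , dup , s) with □*↭∷∷-inv (X ∷ G) dup
  ...   | E , _ , refl , XG↭ , refl =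
    let d′ , h′ = contractˡ (d , h) XG↭ in rC□ m (prep (□ E) s) d′ , s≤s h′
  contractˡ (rC◇ {Γ = G} {A = X} m q d , s≤s h) p with ∷∷↭++-inv (◇ X ∷ □* G) (↭-trans (↭-sym p) q)
  ... | inj₂ (_ , r) = rC◇ m r d , s≤s h
  ... | inj₁ (_ , dup , s) with ◇□*↭∷∷-inv G dup
  ...   | _ , _ , refl , G↭ , Q↭ =
    let d′ , h′ = contractˡ-under (X ∷ []) (d , h) G↭
    in rC◇ m (↭-trans (prep _ s) (++⁺ʳ _ Q↭)) d′ , s≤s h′
  contractˡ (rDualC {Γ = G} {A = X} {B = Y} m q d , s≤s h) p
    with ∷∷↭++-inv (□ X ∷ ◇ Y ∷ □* G) (↭-trans (↭-sym p) q)
  ... | inj₂ (_ , r) = rDualC m r d , s≤s h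
  ... | inj₁ (_ , dup , s) with ◇□*↭∷∷-inv (X ∷ G) (↭-trans (swap (◇ Y) (□ X) ↭-refl) dup)
  ...   | E , _ , refl , XG↭ , Q↭ =
    let d′ , h′ = contractˡ (d , h) (↭-trans (swap X Y ↭-refl) (↭-shifts (Y ∷ []) (E ∷ E ∷ []) XG↭))
    in rDualC m (↭-trans (↭-trans (prep _ s) (++⁺ʳ _ Q↭)) (swap (◇ Y) (□ E) ↭-refl)) d′ , s≤s h′
  contractˡ (rK□ {Γ = G} m q d , s≤s h) p with ∷∷↭++-inv (□* G) (↭-trans (↭-sym p) q)
  ... | inj₂ (_ , r) = rK□ m r d , s≤s h
  ... | inj₁ (_ , dup , s) with □*↭∷∷-inv G dup
  ...   | E , _ , refl , G↭ , refl =
    let d′ , h′ = contractˡ (d , h) G↭ in rK□ m (prep (□ E) s) d′ , s≤s h′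
  contractˡ (rK◇ {Γ = G} {A = X} m q d , s≤s h) p with ∷∷↭++-inv (◇ X ∷ □* G) (↭-trans (↭-sym p) q)
  ... | inj₂ (_ , r) = rK◇ m r d , s≤s h
  ... | inj₁ (_ , dup , s) with ◇□*↭∷∷-inv G dup
  ...   | _ , _ , refl , G↭ , Q↭ =
    let d′ , h′ = contractˡ-under (X ∷ []) (d , h) G↭
    in rK◇ m (↭-trans (prep _ s) (++⁺ʳ _ Q↭)) d′ , s≤s h′
  contractˡ (rDualK {Γ = G} {A = X} m q d , s≤s h) p with ∷∷↭++-inv (◇ X ∷ □* G) (↭-trans (↭-sym p) q)
  ... | inj₂ (_ , r) = rDualK m r d , s≤s h
  ... | inj₁ (_ , dup , s) with ◇□*↭∷∷-inv G dup
  ...   | _ , _ , refl , G↭ , Q↭ =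
    let d′ , h′ = contractˡ-under (X ∷ []) (d , h) G↭
    in rDualK m (↭-trans (prep _ s) (++⁺ʳ _ Q↭)) d′ , s≤s h′
  contractˡ (rT□ {A = X} m q d , s≤s h) p with ∷∷↭∷-inv (↭-trans (↭-sym p) q)
  ... | inj₁ (_ , g , Γ↭) =
    let d′ , h′ = contractˡ-under (X ∷ □ X ∷ []) (d , h) g in rT□ m Γ↭ d′ , s≤s h′
  ... | inj₂ (refl , g) =
    let d′ , h′ = contractˡ-under (X ∷ []) (d , h) (prep (□ X) g) in rT□ m ↭-refl d′ , s≤s h′
  contractˡ (rT◇ m d , s≤s h) p = let d′ , h′ = contractˡ (d , h) p in rT◇ m d′ , s≤s h′
  contractˡ (rP□ m q d , h) p = rP□ m (proj₂ (∷∷↭∷⇒∷↭∷ (↭-trans (↭-sym p) q))) d , h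
  contractˡ (rP◇ m d , h) p = rP◇ m d , h
  contractˡ (rD m q d , h) p = rD m (proj₂ (∷∷↭∷⇒∷↭∷ (↭-trans (↭-sym p) q))) d , h
  contractˡ (rD□ {A = X} {B = Y} m q d , s≤s h) p with ∷∷↭++-inv (□ X ∷ □ Y ∷ []) (↭-trans (↭-sym p) q)
  ... | inj₂ (_ , r) = rD□ m r d , s≤s h
  ... | inj₁ (_ , dup , s) with [x,y]↭∷∷-inv dup
  ...   | refl , refl , refl =
    -- □X, □X contracted: the premiss X ⇒ only yields □X, Γ′ ⇒ Δ through P□
    let d′ , h′ = contractˡ (d , h) ↭-refl in rP□ (has-D□⇒has-P□ m) (prep (□ X) s) d′ , s≤s h′
  contractˡ (rCD {Γ = G} m q d , s≤s h) p with ∷∷↭++-inv (□* G) (↭-trans (↭-sym p) q)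
  ... | inj₂ (_ , r) = rCD m r d , s≤s h
  ... | inj₁ (_ , dup , s) with □*↭∷∷-inv G dup
  ...   | E , _ , refl , G↭ , refl =
    let d′ , h′ = contractˡ (d , h) G↭ in rCD m (prep (□ E) s) d′ , s≤s h′
  contractˡ (rCD□ {Γ = G} m q d , s≤s h) p with ∷∷↭++-inv (□* G) (↭-trans (↭-sym p) q)
  ... | inj₂ (_ , r) = rCD□ m r d , s≤s h
  ... | inj₁ (_ , dup , s) with □*↭∷∷-inv G dup
  ...   | E , _ , refl , G↭ , refl =
    let d′ , h′ = contractˡ (d , h) G↭ in rCD□ m (prep (□ E) s) d′ , s≤s h′

proposition3p1 : (L : Calc) → HPLeftWeakening L × HPRightWeakening L × HPLeftContraction L
proposition3p1 L =
    (λ _ _ A d → weakenˡ A (d , ≤-refl))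
  , (λ _ A d → weakenʳ A (d , ≤-refl))
  , (λ _ _ _ d → contractˡ (d , ≤-refl) ↭-refl)
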